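{- Let $G$ be a finite simple graph on $n$ vertices. If $G$ contains three pairwise adjacent vertices $v_1, v_2, v_3$ such that $N[v_1] = N[v_2] = N[v_3]$, then $\gamma_{gr}^L(G) \neq n$.
   Context: For a vertex $v$, $N(v)$ is its open neighborhood (the set of its neighbors) and $N[v] = N(v) \cup \{v\}$ its closed neighborhood. An L-sequence of $G$ is a sequence $(v_1, \ldots, v_k)$ of distinct vertices of $G$ such that for every $i \in \{1,\ldots,k\}$, $N[v_i] \setminus \bigcup_{j=1}^{i-1} N(v_j) \neq \emptyset$. The L-Grundy domination number $\gamma_{gr}^L(G)$ is the maximum length of an L-sequence of $G$. -}

module Defs where

open import Level using (0ℓ)
open import Data.Nat using (ℕ; _≤_)
open import Data.Fin using (Fin)
open import Data.List using (List; []; _∷_; length)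
open import Data.List.Relation.Unary.Unique.Propositional using (Unique)
open import Data.List.Membership.Propositional using (_∈_)
open import Data.Product using (Σ; ∃; _×_; _,_)
open import Data.Sum using (_⊎_)
open import Data.Empty using (⊥)
open import Relation.Nullary using (¬_)
open import Relation.Binary.PropositionalEquality using (_≡_)

record Graph (n : ℕ) : Set₁ where
  field
    Adj       : Fin n → Fin n → Set
    adj?      : ∀ u v → Adj u v ⊎ ¬ Adj u v
    sym       : ∀ {u v} → Adj u v → Adj v u
    irrefl    : ∀ {u} → ¬ Adj u u

module _ {n : ℕ} (G : Graph n) where
  open Graph G

  InN : Fin n → Fin n → Set
  InN v u = Adj v u

  InN[] : Fin n → Fin n → Set
  InN[] v u = (u ≡ v) ⊎ Adj v u

  NotDominatedBy : List (Fin n) → Fin n → Set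
  NotDominatedBy ws u = ∀ w → w ∈ ws → ¬ InN w u

  -- The L-condition, checked on the reversed prefix (the list of
  -- earlier vertices): N[v] ∖ ⋃_{w ∈ prev} N(w) ≠ ∅.
  -- LSeqFrom prev vs : vs is an L-sequence continuation after prev.
  data LSeqFrom : List (Fin n) → List (Fin n) → Set where
    []  : ∀ {prev} → LSeqFrom prev []
    _∷_ : ∀ {prev v vs} →
          (∃ λ u → InN[] v u × NotDominatedBy prev u) →
          LSeqFrom (v ∷ prev) vs →
          LSeqFrom prev (v ∷ vs)

  IsLSequence : List (Fin n) → Set
  IsLSequence vs = Unique vs × LSeqFrom [] vs

  IsLGrundyNumber : ℕ → Set
  IsLGrundyNumber k =
    (∃ λ vs → IsLSequence vs × length vs ≡ k) ×
    (∀ vs → IsLSequence vs → length vs ≤ k)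

{-# OPTIONS --safe #-}
-- Let c be the vertex of the triangle that appears last in an L-sequence and
-- a, b the two earlier ones; since the three are closed twins,
-- N[c] ⊆ N[a] ∩ N[b]. As a ≠ b, every vertex of N[c] lies in N(a) or in N(b),
-- so c cannot satisfy the L-condition. Hence no L-sequence contains the whole
-- triangle, while an L-sequence of length n contains every vertex.
module Submission where

open import Defs
open import Data.Nat using (ℕ; _≤_)
open import Data.Nat.Properties using (≮⇒≥; <⇒≢)
open import Data.Fin using (Fin; zero; suc)
open import Data.Fin.Properties using (pigeonhole; <-irrefl; _≟_)
open import Data.Product using (_×_; _,_; ∃; proj₁)
open import Data.Sum using (inj₁; inj₂)
open import Data.List using (List; []; _∷_; length; lookup; _ʳ++_)
open import Data.List.Relation.Unary.Any using (here; there; any?)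
open import Data.List.Relation.Unary.Any.Properties using (reverse⁺)
import Data.List.Relation.Unary.All as All
open import Data.List.Relation.Unary.All.Properties using (¬Any⇒All¬)
open import Data.List.Relation.Unary.AllPairs using (_∷_)
open import Data.List.Relation.Unary.Unique.Propositional using (Unique)
open import Data.List.Membership.Propositional using (_∈_)
open import Data.List.Membership.Propositional.Properties using (∈-lookup; ∉[])
open import Function.Base using (_∘_)
open import Function.Definitions using (Injective)
open import Relation.Nullary using (¬_; yes; no; contradiction)
open import Relation.Binary.PropositionalEquality using (_≡_; _≢_; refl; sym; cong)

lookup-injective : {A : Set} {xs : List A} → Unique xs → Injective _≡_ _≡_ (lookup xs)
lookup-injective {xs = _ ∷ _} _ {zero} {zero} _ = refl
lookup-injective {xs = _ ∷ _} (x∉xs ∷ _) {zero} {suc j} eq =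
  contradiction eq (All.lookup x∉xs (∈-lookup j))
lookup-injective {xs = _ ∷ _} (x∉xs ∷ _) {suc i} {zero} eq =
  contradiction (sym eq) (All.lookup x∉xs (∈-lookup i))
lookup-injective {xs = _ ∷ _} (_ ∷ u) {suc i} {suc j} eq = cong suc (lookup-injective u eq)

Unique⇒length≤ : ∀ {n} {xs : List (Fin n)} → Unique xs → length xs ≤ n
Unique⇒length≤ {xs = xs} u = ≮⇒≥ λ n<len →
  let i , j , i<j , eq = pigeonhole n<len (lookup xs)
  in <-irrefl (lookup-injective u eq) i<j

Unique∧length≡⇒∈ : ∀ {n} {xs : List (Fin n)} → Unique xs → length xs ≡ n → ∀ x → x ∈ xs
Unique∧length≡⇒∈ {xs = xs} u length≡n x with any? (x ≟_) xs
... | yes x∈xs = x∈xs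
... | no  x∉xs = contradiction length≡n (<⇒≢ (Unique⇒length≤ (¬Any⇒All¬ xs x∉xs ∷ u)))

module _ {n : ℕ} (G : Graph n) where
  open Graph G

  LCondition : List (Fin n) → Fin n → Set
  LCondition prev v = ∃ λ u → InN[] G v u × NotDominatedBy G prev u

  _⊆N[]_ : Fin n → Fin n → Set
  c ⊆N[] a = ∀ u → InN[] G c u → InN[] G a u

  ¬LCondition-under-edge : ∀ {a b c prev} → a ∈ prev → b ∈ prev → Adj a b →
                           c ⊆N[] a → c ⊆N[] b → ¬ LCondition prev c
  ¬LCondition-under-edge a∈prev b∈prev a~b c⊆a c⊆b (u , u∈N[c] , undominated)
    with c⊆a u u∈N[c] | c⊆b u u∈N[c]
  ... | inj₂ a~u    | _           = undominated _ a∈prev a~u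
  ... | inj₁ _      | inj₂ b~u    = undominated _ b∈prev b~u
  ... | inj₁ refl   | inj₁ refl   = irrefl a~b

  module _ {v₁ v₂ v₃ : Fin n} (v₁~v₂ : Adj v₁ v₂) (v₁~v₃ : Adj v₁ v₃) (v₂~v₃ : Adj v₂ v₃)
           (N₁⊆N₂ : v₁ ⊆N[] v₂) (N₂⊆N₁ : v₂ ⊆N[] v₁)
           (N₂⊆N₃ : v₂ ⊆N[] v₃) (N₃⊆N₂ : v₃ ⊆N[] v₂) where

    TriangleIn : List (Fin n) → Set
    TriangleIn xs = v₁ ∈ xs × v₂ ∈ xs × v₃ ∈ xs

    triangleIn-∷⁻ : ∀ {prev v} → LCondition prev v → TriangleIn (v ∷ prev) → TriangleIn prev
    triangleIn-∷⁻ _ (there p₁ , there p₂ , there p₃) = p₁ , p₂ , p₃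
    triangleIn-∷⁻ _ (here refl , here refl , _) = contradiction v₁~v₂ irrefl
    triangleIn-∷⁻ _ (here refl , _ , here refl) = contradiction v₁~v₃ irrefl
    triangleIn-∷⁻ _ (_ , here refl , here refl) = contradiction v₂~v₃ irrefl
    triangleIn-∷⁻ lc (here refl , there p₂ , there p₃) =
      contradiction lc (¬LCondition-under-edge p₂ p₃ v₂~v₃ N₁⊆N₂ (λ u → N₂⊆N₃ u ∘ N₁⊆N₂ u))
    triangleIn-∷⁻ lc (there p₁ , here refl , there p₃) =
      contradiction lc (¬LCondition-under-edge p₁ p₃ v₁~v₃ N₂⊆N₁ N₂⊆N₃)
    triangleIn-∷⁻ lc (there p₁ , there p₂ , here refl) =
      contradiction lc (¬LCondition-under-edge p₁ p₂ v₁~v₂ (λ u → N₂⊆N₁ u ∘ N₃⊆N₂ u) N₃⊆N₂)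

    -- LSeqFrom stores the earlier vertices in reverse, so vs ʳ++ prev lists
    -- every vertex of the sequence.
    triangleIn-prefix : ∀ {prev vs} → LSeqFrom G prev vs → TriangleIn (vs ʳ++ prev) → TriangleIn prev
    triangleIn-prefix []          t = t
    triangleIn-prefix (lc ∷ rest) t = triangleIn-∷⁻ lc (triangleIn-prefix rest t)

proposition3p3 : (n : ℕ) (G : Graph n) (v₁ v₂ v₃ : Fin n) →
    Graph.Adj G v₁ v₂ → Graph.Adj G v₁ v₃ → Graph.Adj G v₂ v₃ →
    (∀ u → InN[] G v₁ u → InN[] G v₂ u) → (∀ u → InN[] G v₂ u → InN[] G v₁ u) →
    (∀ u → InN[] G v₂ u → InN[] G v₃ u) → (∀ u → InN[] G v₃ u → InN[] G v₂ u) →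
    (k : ℕ) → IsLGrundyNumber G k → k ≢ n
proposition3p3 n G v₁ v₂ v₃ v₁~v₂ v₁~v₃ v₂~v₃ N₁⊆N₂ N₂⊆N₁ N₂⊆N₃ N₃⊆N₂ k
               ((vs , (unique , lseq) , length≡k) , _) refl
  = ∉[] (proj₁ (triangleIn-prefix G v₁~v₂ v₁~v₃ v₂~v₃ N₁⊆N₂ N₂⊆N₁ N₂⊆N₃ N₃⊆N₂ lseq
                                    (inVs v₁ , inVs v₂ , inVs v₃)))
  where
  inVs : ∀ x → x ∈ vs ʳ++ []
  inVs x = reverse⁺ (Unique∧length≡⇒∈ unique length≡k x)
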